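{- The family of all finite Hasse partial orders is not a projective Fraïssé family.
   Context: Let $\mathcal L_R=\{R,\le\}$. A finite Hasse partial order is a finite (discrete) $\mathcal L_R$-structure $P$ where $\le^P$ is a partial order and $a\,R^P\,b$ iff $a=b$ or one of $a,b$ is an immediate $\le^P$-successor of the other. An epimorphism $\varphi:A\to B$ is a surjection with $r^B=(\varphi\times\varphi)[r^A]$ for $r\in\{R,\le\}$. A family $\mathcal G$ is a projective Fraïssé family if (JPP) any two members are epimorphic images of a common member, and (AP) for all $A,B,C\in\mathcal G$ and epimorphisms $\varphi_1:B\to A$, $\varphi_2:C\to A$ there are $D\in\mathcal G$ and epimorphisms $\psi_1:D\to B$, $\psi_2:D\to C$ with $\varphi_1\psi_1=\varphi_2\psi_2$. -}

module Defs where

open import Level using (0ℓ)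
open import Data.Nat using (ℕ; suc)
open import Data.Fin using (Fin)
open import Data.Product using (Σ; ∃; _×_; _,_)
open import Data.Sum using (_⊎_)
open import Data.Empty using (⊥)
open import Relation.Nullary using (¬_)
open import Relation.Binary using (Rel)
open import Relation.Binary.PropositionalEquality using (_≡_)
open import Function.Bundles using (_⇔_)

-- A finite (nonempty) L_R-structure, L_R = {R, ≤}: carrier Fin (suc n)
-- with two binary relations.
record Structure : Set₁ where
  field
    size : ℕ
    R    : Rel (Fin (suc size)) 0ℓ
    Le   : Rel (Fin (suc size)) 0ℓ

  Carrier : Set
  Carrier = Fin (suc size)

open Structure public

ImmSucc : ∀ {A : Set} → Rel A 0ℓ → A → A → Set
ImmSucc _≤_ a b =
  (a ≤ b) × ¬ (a ≡ b) ×
  (∀ c → a ≤ c → c ≤ b → (c ≡ a) ⊎ (c ≡ b))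

IsPartialOrder : ∀ {A : Set} → Rel A 0ℓ → Set
IsPartialOrder _≤_ =
  (∀ a → a ≤ a) ×
  (∀ a b c → a ≤ b → b ≤ c → a ≤ c) ×
  (∀ a b → a ≤ b → b ≤ a → a ≡ b)

IsHassePO : Structure → Set
IsHassePO P =
  IsPartialOrder (Le P) ×
  (∀ a b → R P a b ⇔ ((a ≡ b) ⊎ ImmSucc (Le P) a b ⊎ ImmSucc (Le P) b a))

ImageRel : ∀ {X Y : Set} → (X → Y) → Rel X 0ℓ → Rel Y 0ℓ → Set
ImageRel φ rA rB =
  ∀ y y' → rB y y' ⇔ (Σ _ λ x → Σ _ λ x' → (φ x ≡ y) × (φ x' ≡ y') × rA x x')

IsEpi : (A B : Structure) → (Carrier A → Carrier B) → Set
IsEpi A B φ =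
  (∀ b → ∃ λ a → φ a ≡ b) ×
  ImageRel φ (R A) (R B) ×
  ImageRel φ (Le A) (Le B)

Epi : Structure → Structure → Set
Epi A B = Σ (Carrier A → Carrier B) (IsEpi A B)

JPP : (Structure → Set) → Set₁
JPP 𝒢 = ∀ A B → 𝒢 A → 𝒢 B →
  Σ Structure λ D → 𝒢 D × Epi D A × Epi D B

AP : (Structure → Set) → Set₁
AP 𝒢 = ∀ A B C → 𝒢 A → 𝒢 B → 𝒢 C →
  (φ₁ : Epi B A) (φ₂ : Epi C A) →
  Σ Structure λ D → 𝒢 D × Σ (Epi D B) λ ψ₁ → Σ (Epi D C) λ ψ₂ →
    ∀ d → Σ.proj₁ φ₁ (Σ.proj₁ ψ₁ d) ≡ Σ.proj₁ φ₂ (Σ.proj₁ ψ₂ d)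

IsProjectiveFraisseFamily : (Structure → Set) → Set₁
IsProjectiveFraisseFamily 𝒢 = JPP 𝒢 × AP 𝒢

-- Let A be the diamond 0 < 1, 2 < 3 and B the fence 4 > 0 < 1 < 2 > 3. Two
-- epimorphisms φ₁, φ₂ : B → A wrap B around A in opposite directions (they
-- differ by the automorphism of A swapping 1 and 2). In any Hasse amalgam D,
-- lift 0 ≤ 2 of B along ψ₁ to d ≤ g. On the interval [d, g] the common map
-- f = φ₁ψ₁ = φ₂ψ₂ avoids 2 (seen through ψ₁) and avoids 1 (seen through ψ₂),
-- while f d = 0 and f g = 3. Walking up [d, g], some cover e ⋖ e' of D has
-- f e = 0 and f e' = 3; covers are R-related, so 0 R 3 in A, which is false.
-- The order of D is only decidable under double negation, which suffices
-- since the goal is ⊥.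
module Submission where

open import Defs
open import Level using (0ℓ)
open import Data.Bool using (Bool; T; _∧_; _∨_; false)
open import Data.Bool.Properties using (T?; T-≡)
open import Data.Empty using (⊥)
open import Data.Fin using (Fin; zero; suc; toℕ; #_; _≟_)
open import Data.Fin.Properties using (all?; any?; sequence)
open import Data.Fin.Subset using (Subset; _∈_; _⊂_)
open import Data.Fin.Subset.Induction using (⊂-wellFounded)
open import Data.List using (List; []; _∷_)
open import Data.Nat using (ℕ; suc; _≡ᵇ_)
open import Data.Product using (∃; _×_; _,_; proj₁; proj₂; uncurry)
open import Data.Sum using (_⊎_; inj₁; inj₂)
open import Data.Vec using (tabulate; lookup; []; _∷_)
open import Data.Vec.Properties using (lookup∘tabulate; []=⇒lookup; lookup⇒[]=)
open import Effect.Applicative using (RawApplicative)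
open import Effect.Monad using (RawMonad)
open import Function.Bundles using (_⇔_; mk⇔; Equivalence)
open import Induction.WellFounded using (Acc; acc)
open import Relation.Binary using (Rel)
open import Relation.Binary.Definitions using (Decidable)
open import Relation.Binary.PropositionalEquality using (_≡_; _≢_; refl; sym; trans; cong; subst; subst₂)
open import Relation.Nullary using (¬_; Dec; yes; no)
open import Relation.Nullary.Decidable
  using (_×-dec_; _⊎-dec_; _→-dec_; ¬?; map′; isYes; toWitness; fromWitness; from-yes; ¬¬-excluded-middle)
open import Relation.Nullary.Negation using (¬¬-Monad; contradiction)

¬¬-decidable : ∀ {n} (r : Rel (Fin n) 0ℓ) → ¬ ¬ Decidable r
¬¬-decidable r =
  sequence ¬¬-Applicative λ i → sequence ¬¬-Applicative λ j → ¬¬-excluded-middle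
  where
  ¬¬-Applicative : RawApplicative {0ℓ} (λ A → ¬ ¬ A)
  ¬¬-Applicative = RawMonad.rawApplicative ¬¬-Monad

module CoverSwitch {m : ℕ} {_≤_ : Rel (Fin m) 0ℓ} (_≤?_ : Decidable _≤_)
                   (po : IsPartialOrder _≤_)
                   {Q : Fin m → Set} (Q? : ∀ x → Dec (Q x)) where

  private
    ≤-refl : ∀ a → a ≤ a
    ≤-refl = proj₁ po

    ≤-trans : ∀ a b c → a ≤ b → b ≤ c → a ≤ c
    ≤-trans = proj₁ (proj₂ po)

    ≤-antisym : ∀ a b → a ≤ b → b ≤ a → a ≡ b
    ≤-antisym = proj₂ (proj₂ po)

  record Switch (d g : Fin m) : Set where
    constructor switch
    field
      low high   : Fin m
      low-holds  : Q low
      high-fails : ¬ Q high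
      d≤high     : d ≤ high
      high≤g     : high ≤ g
      low⋖high   : ImmSucc _≤_ low high

  interval : Fin m → Fin m → Subset m
  interval d g = tabulate λ x → isYes (d ≤? x ×-dec x ≤? g)

  ∈-interval⁻ : ∀ {d g x} → x ∈ interval d g → d ≤ x × x ≤ g
  ∈-interval⁻ {x = x} x∈ =
    toWitness (Equivalence.from T-≡ (trans (sym (lookup∘tabulate _ x)) ([]=⇒lookup x∈)))

  ∈-interval⁺ : ∀ {d g x} → d ≤ x → x ≤ g → x ∈ interval d g
  ∈-interval⁺ {d} {g} {x} d≤x x≤g = lookup⇒[]= x (interval d g)
    (trans (lookup∘tabulate _ x) (Equivalence.to T-≡ (fromWitness (d≤x , x≤g))))

  interval-⊂-raise : ∀ {d c g} → d ≤ c → c ≢ d → c ≤ g → interval c g ⊂ interval d g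
  interval-⊂-raise d≤c c≢d c≤g =
    (λ x∈ → let c≤x , x≤g = ∈-interval⁻ x∈ in ∈-interval⁺ (≤-trans _ _ _ d≤c c≤x) x≤g) ,
    _ , ∈-interval⁺ (≤-refl _) (≤-trans _ _ _ d≤c c≤g) ,
    (λ d∈ → c≢d (≤-antisym _ _ (proj₁ (∈-interval⁻ d∈)) d≤c))

  interval-⊂-lower : ∀ {d c g} → d ≤ c → c ≤ g → c ≢ g → interval d c ⊂ interval d g
  interval-⊂-lower d≤c c≤g c≢g =
    (λ x∈ → let d≤x , x≤c = ∈-interval⁻ x∈ in ∈-interval⁺ d≤x (≤-trans _ _ _ x≤c c≤g)) ,
    _ , ∈-interval⁺ (≤-trans _ _ _ d≤c c≤g) (≤-refl _) ,
    (λ g∈ → c≢g (≤-antisym _ _ c≤g (proj₂ (∈-interval⁻ g∈))))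

  StrictlyBetween : Fin m → Fin m → Fin m → Set
  StrictlyBetween d g c = d ≤ c × c ≤ g × c ≢ d × c ≢ g

  covers-or-splits : ∀ {d g} → d ≤ g → d ≢ g → ImmSucc _≤_ d g ⊎ ∃ (StrictlyBetween d g)
  covers-or-splits {d} {g} d≤g d≢g
    with any? (λ c → d ≤? c ×-dec c ≤? g ×-dec ¬? (c ≟ d) ×-dec ¬? (c ≟ g))
  ... | yes c-between = inj₂ c-between
  ... | no no-between = inj₁ (d≤g , d≢g , endpoint)
    where
    endpoint : ∀ c → d ≤ c → c ≤ g → c ≡ d ⊎ c ≡ g
    endpoint c d≤c c≤g with c ≟ d | c ≟ g
    ... | yes c≡d | _       = inj₁ c≡d
    ... | no _    | yes c≡g = inj₂ c≡g
    ... | no c≢d  | no c≢g  = contradiction (c , d≤c , c≤g , c≢d , c≢g) no-between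

  switch-raise : ∀ {d c g} → d ≤ c → Switch c g → Switch d g
  switch-raise d≤c (switch l h ql ¬qh c≤h h≤g l⋖h) =
    switch l h ql ¬qh (≤-trans _ _ _ d≤c c≤h) h≤g l⋖h

  switch-lower : ∀ {d c g} → c ≤ g → Switch d c → Switch d g
  switch-lower c≤g (switch l h ql ¬qh d≤h h≤c l⋖h) =
    switch l h ql ¬qh d≤h (≤-trans _ _ _ h≤c c≤g) l⋖h

  switch-in : ∀ {d g} → Acc _⊂_ (interval d g) → d ≤ g → Q d → ¬ Q g → Switch d g
  switch-in {d} {g} (acc smaller) d≤g qd ¬qg
    with covers-or-splits d≤g (λ d≡g → ¬qg (subst Q d≡g qd))
  ... | inj₁ d⋖g = switch d g qd ¬qg d≤g (≤-refl g) d⋖g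
  ... | inj₂ (c , d≤c , c≤g , c≢d , c≢g) with Q? c
  ...   | yes qc = switch-raise d≤c
                     (switch-in (smaller (interval-⊂-raise d≤c c≢d c≤g)) c≤g qc ¬qg)
  ...   | no ¬qc = switch-lower c≤g
                     (switch-in (smaller (interval-⊂-lower d≤c c≤g c≢g)) d≤c qd ¬qc)

  find-switch : ∀ {d g} → d ≤ g → Q d → ¬ Q g → Switch d g
  find-switch {d} {g} = switch-in (⊂-wellFounded (interval d g))

_⇔-dec_ : ∀ {A B : Set} → Dec A → Dec B → Dec (A ⇔ B)
a? ⇔-dec b? = map′ (uncurry mk⇔) (λ e → Equivalence.to e , Equivalence.from e)
                   ((a? →-dec b?) ×-dec (b? →-dec a?))

module _ {n : ℕ} {_≤_ : Rel (Fin n) 0ℓ} (_≤?_ : Decidable _≤_) where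

  immSucc? : Decidable (ImmSucc _≤_)
  immSucc? a b = a ≤? b ×-dec ¬? (a ≟ b) ×-dec
    all? λ c → a ≤? c →-dec (c ≤? b →-dec (c ≟ a ⊎-dec c ≟ b))

  isPartialOrder? : Dec (IsPartialOrder _≤_)
  isPartialOrder? =
    all? (λ a → a ≤? a) ×-dec
    all? (λ a → all? λ b → all? λ c → a ≤? b →-dec (b ≤? c →-dec a ≤? c)) ×-dec
    all? (λ a → all? λ b → a ≤? b →-dec (b ≤? a →-dec a ≟ b))

isHassePO? : (P : Structure) → Decidable (R P) → Decidable (Le P) → Dec (IsHassePO P)
isHassePO? P R? Le? = isPartialOrder? Le? ×-dec
  all? λ a → all? λ b → R? a b ⇔-dec (a ≟ b ⊎-dec immSucc? Le? a b ⊎-dec immSucc? Le? b a)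

imageRel? : ∀ {m k} (φ : Fin m → Fin k) {rA : Rel (Fin m) 0ℓ} {rB : Rel (Fin k) 0ℓ} →
            Decidable rA → Decidable rB → Dec (ImageRel φ rA rB)
imageRel? φ rA? rB? = all? λ y → all? λ y' → rB? y y' ⇔-dec
  any? λ x → any? λ x' → φ x ≟ y ×-dec φ x' ≟ y' ×-dec rA? x x'

isEpi? : ∀ A B (φ : Carrier A → Carrier B) →
         Decidable (R A) → Decidable (Le A) → Decidable (R B) → Decidable (Le B) →
         Dec (IsEpi A B φ)
isEpi? A B φ RA? LeA? RB? LeB? =
  all? (λ b → any? λ a → φ a ≟ b) ×-dec imageRel? φ RA? RB? ×-dec imageRel? φ LeA? LeB?

ImageRel-preserves : ∀ {X Y : Set} {φ : X → Y} {rX : Rel X 0ℓ} {rY : Rel Y 0ℓ} →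
                     ImageRel φ rX rY → ∀ {x x'} → rX x x' → rY (φ x) (φ x')
ImageRel-preserves img {x} {x'} r = Equivalence.from (img _ _) (x , x' , refl , refl , r)

ImmSucc⇒R : ∀ {P} → IsHassePO P → ∀ {a b} → ImmSucc (Le P) a b → R P a b
ImmSucc⇒R (_ , R⇔) a⋖b = Equivalence.from (R⇔ _ _) (inj₂ (inj₁ a⋖b))

-- Order and cover relations listed as pairs of indices; R is the reflexive
-- symmetric closure of the covers.
fromPairs : (n : ℕ) (order covers : List (ℕ × ℕ)) → Structure
fromPairs n order covers = record
  { size = n
  ; R    = λ i j → T ((toℕ i ≡ᵇ toℕ j) ∨ listed i j covers ∨ listed j i covers)
  ; Le   = λ i j → T (listed i j order)
  }
  where
  listed : Fin (suc n) → Fin (suc n) → List (ℕ × ℕ) → Bool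
  listed i j []             = false
  listed i j ((a , b) ∷ ps) = ((toℕ i ≡ᵇ a) ∧ (toℕ j ≡ᵇ b)) ∨ listed i j ps

module _ (n : ℕ) (order covers : List (ℕ × ℕ)) where

  R-fromPairs? : Decidable (R (fromPairs n order covers))
  R-fromPairs? i j = T? _

  Le-fromPairs? : Decidable (Le (fromPairs n order covers))
  Le-fromPairs? i j = T? _

  isHassePO-fromPairs? : Dec (IsHassePO (fromPairs n order covers))
  isHassePO-fromPairs? = isHassePO? _ R-fromPairs? Le-fromPairs?

isEpi-fromPairs? : ∀ n order covers n' order' covers' (φ : Fin (suc n) → Fin (suc n')) →
                   Dec (IsEpi (fromPairs n order covers) (fromPairs n' order' covers') φ)
isEpi-fromPairs? n order covers n' order' covers' φ = isEpi? _ _ φ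
  (R-fromPairs? n order covers) (Le-fromPairs? n order covers)
  (R-fromPairs? n' order' covers') (Le-fromPairs? n' order' covers')

diamond-order diamond-covers fence-order fence-covers : List (ℕ × ℕ)
diamond-order  = (0 , 0) ∷ (0 , 1) ∷ (0 , 2) ∷ (0 , 3) ∷ (1 , 1) ∷ (1 , 3) ∷ (2 , 2) ∷ (2 , 3) ∷ (3 , 3) ∷ []
diamond-covers = (0 , 1) ∷ (0 , 2) ∷ (1 , 3) ∷ (2 , 3) ∷ []
fence-order    = (0 , 0) ∷ (0 , 1) ∷ (0 , 2) ∷ (0 , 4) ∷ (1 , 1) ∷ (1 , 2) ∷ (2 , 2) ∷ (3 , 3) ∷ (3 , 2) ∷ (4 , 4) ∷ []
fence-covers   = (0 , 1) ∷ (1 , 2) ∷ (3 , 2) ∷ (0 , 4) ∷ []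

diamond fence : Structure
diamond = fromPairs 3 diamond-order diamond-covers
fence   = fromPairs 4 fence-order fence-covers

Le-fence? : Decidable (Le fence)
Le-fence? = Le-fromPairs? 4 fence-order fence-covers

φ₁ φ₂ : Carrier fence → Carrier diamond
φ₁ = lookup (# 0 ∷ # 1 ∷ # 3 ∷ # 2 ∷ # 2 ∷ [])
φ₂ = lookup (# 0 ∷ # 2 ∷ # 3 ∷ # 1 ∷ # 1 ∷ [])

diamond-isHassePO : IsHassePO diamond
diamond-isHassePO = from-yes (isHassePO-fromPairs? 3 diamond-order diamond-covers)

fence-isHassePO : IsHassePO fence
fence-isHassePO = from-yes (isHassePO-fromPairs? 4 fence-order fence-covers)

φ₁-isEpi : IsEpi fence diamond φ₁
φ₁-isEpi = from-yes (isEpi-fromPairs? 4 fence-order fence-covers 3 diamond-order diamond-covers φ₁)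

φ₂-isEpi : IsEpi fence diamond φ₂
φ₂-isEpi = from-yes (isEpi-fromPairs? 4 fence-order fence-covers 3 diamond-order diamond-covers φ₂)

¬R-diamond-bottom-top : ¬ R diamond (# 0) (# 3)
¬R-diamond-bottom-top ()

φ₁-avoids-2 : ∀ b → Le fence (# 0) b → Le fence b (# 2) → φ₁ b ≢ # 2
φ₁-avoids-2 = from-yes (all? λ b →
  Le-fence? (# 0) b →-dec (Le-fence? b (# 2) →-dec ¬? (φ₁ b ≟ # 2)))

φ₂-avoids-1 : ∀ x y z → Le fence x y → Le fence y z →
              φ₂ x ≡ # 0 → φ₂ z ≡ # 3 → φ₂ y ≢ # 1
φ₂-avoids-1 = from-yes (all? λ x → all? λ y → all? λ z →
  Le-fence? x y →-dec (Le-fence? y z →-dec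
    (φ₂ x ≟ # 0 →-dec (φ₂ z ≟ # 3 →-dec ¬? (φ₂ y ≟ # 1)))))

bottom-or-top : (a : Carrier diamond) → a ≢ # 1 → a ≢ # 2 → a ≡ # 0 ⊎ a ≡ # 3
bottom-or-top zero                   _   _   = inj₁ refl
bottom-or-top (suc zero)             a≢1 _   = contradiction refl a≢1
bottom-or-top (suc (suc zero))       _   a≢2 = contradiction refl a≢2
bottom-or-top (suc (suc (suc zero))) _   _   = inj₂ refl

module NoAmalgam (D : Structure) (D-isHassePO : IsHassePO D)
                 {ψ₁ ψ₂ : Carrier D → Carrier fence}
                 (ψ₁-isEpi : IsEpi D fence ψ₁) (ψ₂-isEpi : IsEpi D fence ψ₂)
                 (commutes : ∀ x → φ₁ (ψ₁ x) ≡ φ₂ (ψ₂ x)) where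

  f : Carrier D → Carrier diamond
  f x = φ₁ (ψ₁ x)

  ψ₁-monotone : ∀ {x y} → Le D x y → Le fence (ψ₁ x) (ψ₁ y)
  ψ₁-monotone = ImageRel-preserves (proj₂ (proj₂ ψ₁-isEpi))

  ψ₂-monotone : ∀ {x y} → Le D x y → Le fence (ψ₂ x) (ψ₂ y)
  ψ₂-monotone = ImageRel-preserves (proj₂ (proj₂ ψ₂-isEpi))

  f-preserves-R : ∀ {x y} → R D x y → R diamond (f x) (f y)
  f-preserves-R {x} {y} r = ImageRel-preserves (proj₁ (proj₂ φ₁-isEpi)) {ψ₁ x} {ψ₁ y}
                              (ImageRel-preserves (proj₁ (proj₂ ψ₁-isEpi)) r)

  module _ {d g : Carrier D} (ψ₁d≡0 : ψ₁ d ≡ # 0) (ψ₁g≡2 : ψ₁ g ≡ # 2) where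

    f-on-interval : ∀ {e} → Le D d e → Le D e g → f e ≡ # 0 ⊎ f e ≡ # 3
    f-on-interval {e} d≤e e≤g = bottom-or-top (f e) fe≢1 fe≢2
      where
      fe≢2 : f e ≢ # 2
      fe≢2 = φ₁-avoids-2 (ψ₁ e) (subst (λ b → Le fence b (ψ₁ e)) ψ₁d≡0 (ψ₁-monotone d≤e))
                                (subst (Le fence (ψ₁ e)) ψ₁g≡2 (ψ₁-monotone e≤g))
      fe≢1 : f e ≢ # 1
      fe≢1 fe≡1 = φ₂-avoids-1 (ψ₂ d) (ψ₂ e) (ψ₂ g) (ψ₂-monotone d≤e) (ψ₂-monotone e≤g)
        (trans (sym (commutes d)) (cong φ₁ ψ₁d≡0)) (trans (sym (commutes g)) (cong φ₁ ψ₁g≡2))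
        (trans (sym (commutes e)) fe≡1)

    no-bottom-top-switch : Decidable (Le D) → Le D d g → ⊥
    no-bottom-top-switch _≤?_ d≤g = switch-absurd (find-switch d≤g (cong φ₁ ψ₁d≡0) fg≢0)
      where
      open CoverSwitch _≤?_ (proj₁ D-isHassePO) (λ x → f x ≟ # 0)

      fg≢0 : f g ≢ # 0
      fg≢0 fg≡0 with trans (sym (cong φ₁ ψ₁g≡2)) fg≡0
      ... | ()

      switch-absurd : Switch d g → ⊥
      switch-absurd (switch e e' fe≡0 fe'≢0 d≤e' e'≤g e⋖e') = ¬R-diamond-bottom-top
        (subst₂ (R diamond) fe≡0 fe'≡3 (f-preserves-R (ImmSucc⇒R D-isHassePO e⋖e')))
        where
        fe'≡3 : f e' ≡ # 3
        fe'≡3 with f-on-interval d≤e' e'≤g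
        ... | inj₁ fe'≡0 = contradiction fe'≡0 fe'≢0
        ... | inj₂ fe'≡3 = fe'≡3

  absurd : Decidable (Le D) → ⊥
  absurd _≤?_ with Equivalence.to (proj₂ (proj₂ ψ₁-isEpi) (# 0) (# 2)) _
  ... | d , g , ψ₁d≡0 , ψ₁g≡2 , d≤g = no-bottom-top-switch ψ₁d≡0 ψ₁g≡2 _≤?_ d≤g

proposition3p5 : ¬ IsProjectiveFraisseFamily IsHassePO
proposition3p5 (_ , amalgamate)
  with amalgamate diamond fence fence diamond-isHassePO fence-isHassePO fence-isHassePO
                  (φ₁ , φ₁-isEpi) (φ₂ , φ₂-isEpi)
... | D , D-isHassePO , (_ , ψ₁-isEpi) , (_ , ψ₂-isEpi) , commutes =
  ¬¬-decidable (Le D) (NoAmalgam.absurd D D-isHassePO ψ₁-isEpi ψ₂-isEpi commutes)
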